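{- Let $r\geq 2$ and $1\leq i\leq r$ be integers. Then $\mathcal{B}_{r,i}=\mathcal{D}_{r,i}$.
   Context: A partition $\lambda=(\lambda_1,\dots,\lambda_s)$ is a non-increasing finite sequence of positive integers (the empty partition has $s=0$); row $m$ of its Young diagram (counted from the top) has $\lambda_m$ boxes. Durfee dissections. For a (possibly empty) partition $\mu=(\mu_1,\dots,\mu_t)$ let $\mathrm{sq}(\mu)=\max\{d\geq 0: d\leq t,\ \mu_d\geq d\}$ (side of its Durfee square, the largest $d\times d$ square in the top-left corner of the diagram) and $\mathrm{rect}(\mu)=\max\{h\geq 0: h\leq t,\ \mu_h\geq h+1\}$ (height of its horizontal Durfee rectangle, the largest rectangle with $h$ rows and $h+1$ columns in the top-left corner; $h=0$ is allowed). For an integer $k\geq 0$, the $k$-Durfee dissection of $\lambda$ is given by $\mu^{(0)}=\lambda$ and, for $j\geq1$, $c_j=\mathrm{rect}(\mu^{(j-1)})$ if $j\leq k$, $c_j=\mathrm{sq}(\mu^{(j-1)})$ if $j>k$, and $\mu^{(j)}$ is $\mu^{(j-1)}$ with its first $c_j$ parts deleted. $\mathcal{D}_{r,i}$ is the set of partitions $\lambda$ for which, in the $(r-i)$-Durfee dissection, $\mu^{(r-1)}$ is empty (i.e. $r-i$ successive horizontal Durfee rectangles followed by $i-1$ successive Durfee squares exhaust all rows). Bottom dissections. For a nonempty partition $\nu=(\nu_1,\dots,\nu_t)$, removing its bottom square (side $\nu_t$, bottom edge on the bottom of the diagram) means deleting its last $\min(\nu_t,t)$ parts, and removing its bottom rectangle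 (width $\nu_t$, height $\nu_t-1$) means deleting its last $\min(\nu_t-1,t)$ parts; on the empty partition both operations do nothing. For $k\geq0$, the $k$-bottom dissection of $\lambda$ is given by $\nu^{(0)}=\lambda$ and $\nu^{(j)}$ obtained from $\nu^{(j-1)}$ by removing its bottom square if $j\leq k$ and its bottom rectangle if $j>k$. $\mathcal{B}_{r,i}$ is the set of partitions $\lambda$ for which, in the $(i-1)$-bottom dissection, $\nu^{(r-1)}$ is empty. -}

module Defs where

open import Data.Nat using (ℕ; zero; suc; _∸_; _≤_; _<_; _≤ᵇ_)
open import Data.Bool using (Bool; true; false; if_then_else_; _∧_)
open import Data.List using (List; []; _∷_; length; drop; take; reverse; last)
open import Data.List.Relation.Unary.All using (All)
open import Data.List.Relation.Unary.Linked using (Linked)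
open import Data.Maybe using (Maybe; just; nothing)
open import Relation.Binary.PropositionalEquality using (_≡_)
open import Data.Nat using (_≥_)

record IsPartition (l : List ℕ) : Set where
  field
    nonIncreasing : Linked _≥_ l
    positive      : All (λ x → 0 < x) l

-- 1-based entry μ_d of a list (0 when out of range; only used for d ≤ length).
entry : List ℕ → ℕ → ℕ
entry []       _             = 0
entry (x ∷ xs) zero          = 0
entry (x ∷ xs) (suc zero)    = x
entry (x ∷ xs) (suc (suc d)) = entry xs (suc d)

largestUpTo : (ℕ → Bool) → ℕ → ℕ
largestUpTo P zero    = zero
largestUpTo P (suc n) = if P (suc n) then suc n else largestUpTo P n

sq : List ℕ → ℕ
sq μ = largestUpTo (λ d → d ≤ᵇ entry μ d) (length μ)

rect : List ℕ → ℕ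
rect μ = largestUpTo (λ h → suc h ≤ᵇ entry μ h) (length μ)

durfee : ℕ → ℕ → List ℕ → List ℕ
durfee k zero    l = l
durfee k (suc j) l =
  let μ = durfee k j l
      c = if suc j ≤ᵇ k then rect μ else sq μ
  in drop c μ

InD : ℕ → ℕ → List ℕ → Set
InD r i l = durfee (r ∸ i) (r ∸ 1) l ≡ []

dropLast : ℕ → List ℕ → List ℕ
dropLast m l = take (length l ∸ m) l

-- last part ν_t of a list (0 for the empty list; then t = 0 and removal is a no-op).
lastPart : List ℕ → ℕ
lastPart [] = 0
lastPart (x ∷ []) = x
lastPart (x ∷ y ∷ ys) = lastPart (y ∷ ys)

removeBottomSquare : List ℕ → List ℕ
removeBottomSquare ν = dropLast (lastPart ν) ν

removeBottomRect : List ℕ → List ℕ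
removeBottomRect ν = dropLast (lastPart ν ∸ 1) ν

bottom : ℕ → ℕ → List ℕ → List ℕ
bottom k zero    l = l
bottom k (suc j) l =
  let ν = bottom k j l
  in if suc j ≤ᵇ k then removeBottomSquare ν else removeBottomRect ν

InB : ℕ → ℕ → List ℕ → Set
InB r i l = bottom (i ∸ 1) (r ∸ 1) l ≡ []

-- Both dissections cut the diagram into horizontal strips, so only the number of rows
-- consumed matters. Among the first c rows, the bottom block of excess e (width = height + e)
-- leaves bottomStep c rows; after the first a rows, the greedy top block of excess e reaches
-- row topStep a. For a non-increasing λ these are adjoint: c ≤ topStep a ⇔ bottomStep c ≤ a.
-- Composing the adjunctions reverses the order of the steps, so r−1 top steps with excesses
-- 1,…,1,0,…,0 (r−i rectangles, then squares) consume every row iff the bottom steps with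
-- excesses 0,…,0,1,…,1 (i−1 squares, then rectangles), started from all rows, leave none.
module Submission where

open import Defs
open import Data.Bool using (true; false; if_then_else_; T)
open import Data.Empty using (⊥-elim)
open import Data.List using (List; []; _∷_; length; drop; take)
open import Data.List.Properties using (length-take; length-drop; take-take; take-all; drop-drop; drop-all)
open import Data.List.Relation.Unary.Linked using (Linked; []; [-]; _∷_)
open import Data.Nat using (ℕ; zero; suc; _+_; _∸_; _⊓_; _≤_; _<_; _≥_; _≤ᵇ_; _≤′_; ≤′-refl; ≤′-reflexive; ≤′-step; z≤n; s≤s; s≤s⁻¹; z<s)
open import Data.Nat.Properties
open import Data.Product using (_×_; _,_)
open import Data.Sum using (_⊎_; inj₁; inj₂)
import Data.Sum as Sum
open import Function.Bundles using (_⇔_; mk⇔; Equivalence)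
import Function.Properties.Equivalence as ⇔
open import Relation.Binary.PropositionalEquality
open import Relation.Nullary.Decidable using (yes; no; dec-true; dec-false)


≤ᵇ-true : ∀ {m n} → m ≤ n → (m ≤ᵇ n) ≡ true
≤ᵇ-true {m} {n} = dec-true (m ≤? n)

≤ᵇ-false : ∀ {m n} → n < m → (m ≤ᵇ n) ≡ false
≤ᵇ-false {m} {n} n<m = dec-false (m ≤? n) (<⇒≱ n<m)

largestUpTo-maximal : ∀ P {n d} → T (P d) → d ≤ n → d ≤ largestUpTo P n
largestUpTo-maximal P {zero} _ z≤n = z≤n
largestUpTo-maximal P {suc n} Pd d≤1+n with P (suc n) in eq
... | true  = d≤1+n
... | false with m≤n⇒m<n∨m≡n d≤1+n
...   | inj₁ d<1+n = largestUpTo-maximal P Pd (s≤s⁻¹ d<1+n)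
...   | inj₂ refl  = ⊥-elim (subst T eq Pd)

largestUpTo-satisfies : ∀ P n → largestUpTo P n ≡ 0 ⊎ T (P (largestUpTo P n))
largestUpTo-satisfies P zero = inj₁ refl
largestUpTo-satisfies P (suc n) with P (suc n) in eq
... | true  = inj₂ (subst T (sym eq) _)
... | false = largestUpTo-satisfies P n

largestUpTo-cong : ∀ {P Q} → (∀ d → P d ≡ Q d) → ∀ n → largestUpTo P n ≡ largestUpTo Q n
largestUpTo-cong P≗Q zero = refl
largestUpTo-cong P≗Q (suc n)
  rewrite P≗Q (suc n) | largestUpTo-cong P≗Q n = refl

topBlock : ℕ → List ℕ → ℕ
topBlock e μ = largestUpTo (λ d → d + e ≤ᵇ entry μ d) (length μ)

sq≡topBlock0 : ∀ μ → sq μ ≡ topBlock 0 μ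
sq≡topBlock0 μ = largestUpTo-cong (λ d → cong (_≤ᵇ entry μ d) (sym (+-identityʳ d))) (length μ)

rect≡topBlock1 : ∀ μ → rect μ ≡ topBlock 1 μ
rect≡topBlock1 μ = largestUpTo-cong (λ h → cong (_≤ᵇ entry μ h) (+-comm 1 h)) (length μ)

topBlock-maximal : ∀ {e μ d} → d + e ≤ entry μ d → d ≤ length μ → d ≤ topBlock e μ
topBlock-maximal d+e≤μd d≤len = largestUpTo-maximal _ (≤⇒≤ᵇ d+e≤μd) d≤len

topBlock-fits : ∀ e μ → topBlock e μ ≡ 0 ⊎ topBlock e μ + e ≤ entry μ (topBlock e μ)
topBlock-fits e μ = Sum.map₂ (≤ᵇ⇒≤ _ _) (largestUpTo-satisfies _ (length μ))

entry-drop : ∀ a l {d} → 0 < d → entry (drop a l) d ≡ entry l (a + d)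
entry-drop zero    l        _                = refl
entry-drop (suc a) []       {suc d} _        = refl
entry-drop (suc a) (x ∷ xs) {suc d} _ rewrite +-suc a d =
  trans (entry-drop a xs z<s) (cong (entry xs) (+-suc a d))

entry-suc-≤ : ∀ {l} → Linked _≥_ l → ∀ d → entry l (suc (suc d)) ≤ entry l (suc d)
entry-suc-≤ []            _       = z≤n
entry-suc-≤ [-]           _       = z≤n
entry-suc-≤ (x≥y ∷ _)     zero    = x≥y
entry-suc-≤ (_   ∷ y∷ys↓) (suc d) = entry-suc-≤ y∷ys↓ d

entry-antitone : ∀ {l} → Linked _≥_ l → ∀ {c′ c} → 0 < c′ → c′ ≤′ c → entry l c ≤ entry l c′
entry-antitone l↓ _ ≤′-refl = ≤-refl
entry-antitone l↓ {c′} 0<c′ (≤′-step {suc c} c′≤′c) =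
  ≤-trans (entry-suc-≤ l↓ c) (entry-antitone l↓ 0<c′ c′≤′c)
entry-antitone l↓ {suc _} _ (≤′-step {zero} (≤′-reflexive ()))

-- Rows a+1, …, c of the diagram of l hold a block of height c ∸ a and width c ∸ a + e;
-- only the bottom row c is checked, which suffices when l is non-increasing.
record Block (l : List ℕ) (e a c : ℕ) : Set where
  constructor block
  field
    ordered : a ≤ c
    fits    : a < c → c ∸ a + e ≤ entry l c

Block-shrinkFromTop : ∀ {l e a a′ c} → a ≤ a′ → a′ ≤ c → Block l e a c → Block l e a′ c
Block-shrinkFromTop {e = e} {c = c} a≤a′ a′≤c (block _ fits) =
  block a′≤c (λ a′<c → ≤-trans (+-monoˡ-≤ e (∸-monoʳ-≤ c a≤a′)) (fits (≤-<-trans a≤a′ a′<c)))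

Block-shrinkFromBottom : ∀ {l e a c′ c} → Linked _≥_ l → a ≤ c′ → c′ ≤ c → Block l e a c → Block l e a c′
Block-shrinkFromBottom {e = e} {a} l↓ a≤c′ c′≤c (block _ fits) =
  block a≤c′ (λ a<c′ → ≤-trans (+-monoˡ-≤ e (∸-monoˡ-≤ a c′≤c))
                       (≤-trans (fits (<-≤-trans a<c′ c′≤c))
                                (entry-antitone l↓ (≤-<-trans z≤n a<c′) (≤⇒≤′ c′≤c))))

topStep : List ℕ → ℕ → ℕ → ℕ
topStep l e a = a + topBlock e (drop a l)

topStep-block : ∀ l e a → Block l e a (topStep l e a)
topStep-block l e a = block (m≤m+n a t) fits
  where
  open ≤-Reasoning
  t = topBlock e (drop a l)
  0<t : a < a + t → 0 < t
  0<t a<a+t = subst (0 <_) (m+n∸m≡n a t) (m<n⇒0<n∸m a<a+t)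
  fits : a < a + t → a + t ∸ a + e ≤ entry l (a + t)
  fits a<a+t with topBlock-fits e (drop a l)
  ... | inj₁ t≡0 = ⊥-elim (<⇒≢ (0<t a<a+t) (sym t≡0))
  ... | inj₂ t+e≤ = begin
    a + t ∸ a + e              ≡⟨ cong (_+ e) (m+n∸m≡n a t) ⟩
    t + e                      ≤⟨ t+e≤ ⟩
    entry (drop a l) t         ≡⟨ entry-drop a l (0<t a<a+t) ⟩
    entry l (a + t)            ∎

block⇒≤topStep : ∀ {l e a c} → Block l e a c → c ≤ length l → c ≤ topStep l e a
block⇒≤topStep {l} {e} {a} {c} (block a≤c fits) c≤len with m≤n⇒m<n∨m≡n a≤c
... | inj₂ refl = m≤m+n a _
... | inj₁ a<c  = begin
  c                             ≡⟨ m+[n∸m]≡n a≤c ⟨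
  a + (c ∸ a)                   ≤⟨ +-monoʳ-≤ a (topBlock-maximal {e} {drop a l} fits′ c∸a≤len) ⟩
  topStep l e a                 ∎
  where
  open ≤-Reasoning
  fits′ : c ∸ a + e ≤ entry (drop a l) (c ∸ a)
  fits′ = begin
    c ∸ a + e                 ≤⟨ fits a<c ⟩
    entry l c                 ≡⟨ cong (entry l) (m+[n∸m]≡n a≤c) ⟨
    entry l (a + (c ∸ a))     ≡⟨ entry-drop a l (m<n⇒0<n∸m a<c) ⟨
    entry (drop a l) (c ∸ a)  ∎
  c∸a≤len : c ∸ a ≤ length (drop a l)
  c∸a≤len = subst (c ∸ a ≤_) (sym (length-drop a l)) (∸-monoˡ-≤ a c≤len)

bottomStep : List ℕ → ℕ → ℕ → ℕ
bottomStep l e c = c ∸ (entry l c ∸ e)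

bottomStep-≤ : ∀ l e c → bottomStep l e c ≤ c
bottomStep-≤ l e c = m∸n≤m c (entry l c ∸ e)

bottomStep-block : ∀ l e c → Block l e (bottomStep l e c) c
bottomStep-block l e c = block (bottomStep-≤ l e c) fits
  where
  open ≤-Reasoning
  y = entry l c ∸ e
  fits : c ∸ y < c → c ∸ (c ∸ y) + e ≤ entry l c
  fits c∸y<c = begin
    c ∸ (c ∸ y) + e  ≤⟨ +-monoˡ-≤ e c∸[c∸y]≤y ⟩
    y + e            ≡⟨ m∸n+n≡m (<⇒≤ e<lc) ⟩
    entry l c        ∎
    where
    c∸[c∸y]≤y : c ∸ (c ∸ y) ≤ y
    c∸[c∸y]≤y = m≤n+o⇒m∸n≤o c (c ∸ y) (subst (c ≤_) (+-comm y (c ∸ y)) (m≤n+m∸n c y))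
    -- c ∸ y < c forces y > 0, so the subtraction in y is not truncated.
    e<lc : e < entry l c
    e<lc = m∸n≢0⇒n<m (m<n⇒n≢0 (∸-cancelʳ-< {n = 0} {o = c} c∸y<c))

block⇒bottomStep≤ : ∀ {l e a c} → Block l e a c → bottomStep l e c ≤ a
block⇒bottomStep≤ {l} {e} {a} {c} (block a≤c fits) with m≤n⇒m<n∨m≡n a≤c
... | inj₂ refl = bottomStep-≤ l e a
... | inj₁ a<c  = begin
  c ∸ (entry l c ∸ e)  ≤⟨ ∸-monoʳ-≤ c (m+n≤o⇒m≤o∸n (c ∸ a) (fits a<c)) ⟩
  c ∸ (c ∸ a)          ≡⟨ m∸[m∸n]≡n a≤c ⟩
  a                    ∎
  where open ≤-Reasoning

topStep-galois : ∀ {l e a c} → Linked _≥_ l → c ≤ length l →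
                 c ≤ topStep l e a ⇔ bottomStep l e c ≤ a
topStep-galois {l} {e} {a} {c} l↓ c≤len = mk⇔ to from
  where
  to : c ≤ topStep l e a → bottomStep l e c ≤ a
  to c≤top with ≤-total a c
  ... | inj₁ a≤c = block⇒bottomStep≤ (Block-shrinkFromBottom l↓ a≤c c≤top (topStep-block l e a))
  ... | inj₂ c≤a = ≤-trans (bottomStep-≤ l e c) c≤a
  from : bottomStep l e c ≤ a → c ≤ topStep l e a
  from bot≤a with ≤-total a c
  ... | inj₁ a≤c = block⇒≤topStep (Block-shrinkFromTop bot≤a a≤c (bottomStep-block l e c)) c≤len
  ... | inj₂ c≤a = ≤-trans c≤a (m≤m+n a _)

topSteps : List ℕ → (ℕ → ℕ) → ℕ → ℕ → ℕ
topSteps l e zero    a = a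
topSteps l e (suc j) a = topStep l (e (suc j)) (topSteps l e j a)

bottomSteps : List ℕ → (ℕ → ℕ) → ℕ → ℕ → ℕ
bottomSteps l f zero    c = c
bottomSteps l f (suc j) c = bottomStep l (f (suc j)) (bottomSteps l f j c)

bottomSteps-unfoldˡ : ∀ l f n c →
  bottomSteps l f (suc n) c ≡ bottomSteps l (λ j → f (suc j)) n (bottomStep l (f 1) c)
bottomSteps-unfoldˡ l f zero    c = refl
bottomSteps-unfoldˡ l f (suc n) c = cong (bottomStep l (f (suc (suc n)))) (bottomSteps-unfoldˡ l f n c)

bottomSteps-cong : ∀ l {f g} → (∀ j → f j ≡ g j) → ∀ n c → bottomSteps l f n c ≡ bottomSteps l g n c
bottomSteps-cong l f≗g zero    c = refl
bottomSteps-cong l f≗g (suc n) c = cong₂ (bottomStep l) (f≗g (suc n)) (bottomSteps-cong l f≗g n c)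

bottomSteps-≤ : ∀ l f n c → bottomSteps l f n c ≤ c
bottomSteps-≤ l f zero    c = ≤-refl
bottomSteps-≤ l f (suc n) c = ≤-trans (bottomStep-≤ l (f (suc n)) _) (bottomSteps-≤ l f n c)

-- Galois connections compose, in reverse order.
topSteps-galois : ∀ {l} → Linked _≥_ l → ∀ e n {a c} → c ≤ length l →
                  c ≤ topSteps l e n a ⇔ bottomSteps l (λ j → e (suc n ∸ j)) n c ≤ a
topSteps-galois l↓ e zero    c≤len = ⇔.refl
topSteps-galois {l} l↓ e (suc n) {a} {c} c≤len
  rewrite bottomSteps-unfoldˡ l (λ j → e (suc (suc n) ∸ j)) n c =
  ⇔.trans (topStep-galois l↓ c≤len)
          (topSteps-galois l↓ e n (≤-trans (bottomStep-≤ l (e (suc n)) c) c≤len))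

durfeeExcess : ℕ → ℕ → ℕ
durfeeExcess k j = if j ≤ᵇ k then 1 else 0

bottomExcess : ℕ → ℕ → ℕ
bottomExcess k j = if j ≤ᵇ k then 0 else 1

rectOrSq≡topBlock : ∀ b μ → (if b then rect μ else sq μ) ≡ topBlock (if b then 1 else 0) μ
rectOrSq≡topBlock true  μ = rect≡topBlock1 μ
rectOrSq≡topBlock false μ = sq≡topBlock0 μ

durfee≡drop-topSteps : ∀ k j l → durfee k j l ≡ drop (topSteps l (durfeeExcess k) j 0) l
durfee≡drop-topSteps k zero    l = refl
durfee≡drop-topSteps k (suc j) l rewrite durfee≡drop-topSteps k j l =
  trans (cong (λ t → drop t (drop a l)) (rectOrSq≡topBlock (suc j ≤ᵇ k) (drop a l))) (drop-drop a _ l)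
  where a = topSteps l (durfeeExcess k) j 0

lastPart-take : ∀ l q → q ≤ length l → lastPart (take q l) ≡ entry l q
lastPart-take []           zero          _       = refl
lastPart-take (x ∷ xs)     zero          _       = refl
lastPart-take (x ∷ xs)     (suc zero)    _       = refl
lastPart-take (x ∷ [])     (suc (suc q)) (s≤s ())
lastPart-take (x ∷ y ∷ ys) (suc (suc q)) (s≤s q≤) = lastPart-take (y ∷ ys) (suc q) q≤

dropLast-take : ∀ l q m → q ≤ length l → dropLast m (take q l) ≡ take (q ∸ m) l
dropLast-take l q m q≤len = begin
  take (length (take q l) ∸ m) (take q l)  ≡⟨ cong (λ t → take (t ∸ m) (take q l))
                                                   (trans (length-take q l) (m≤n⇒m⊓n≡m q≤len)) ⟩
  take (q ∸ m) (take q l)                  ≡⟨ take-take (q ∸ m) q l ⟩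
  take ((q ∸ m) ⊓ q) l                     ≡⟨ cong (λ t → take t l) (m≤n⇒m⊓n≡m (m∸n≤m q m)) ⟩
  take (q ∸ m) l                           ∎
  where open ≡-Reasoning

removeBottom-take : ∀ b l q → q ≤ length l →
  (if b then removeBottomSquare (take q l) else removeBottomRect (take q l))
    ≡ take (bottomStep l (if b then 0 else 1) q) l
removeBottom-take b l q q≤len
  rewrite lastPart-take l q q≤len with b
... | true  = dropLast-take l q (entry l q) q≤len
... | false = dropLast-take l q (entry l q ∸ 1) q≤len

bottom≡take-bottomSteps : ∀ k j l → bottom k j l ≡ take (bottomSteps l (bottomExcess k) j (length l)) l
bottom≡take-bottomSteps k zero    l = sym (take-all (length l) l ≤-refl)
bottom≡take-bottomSteps k (suc j) l rewrite bottom≡take-bottomSteps k j l =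
  removeBottom-take (suc j ≤ᵇ k) l _ (bottomSteps-≤ l (bottomExcess k) j (length l))

bottomExcess≡reversed-durfeeExcess : ∀ {k n} → k ≤ n →
  ∀ j → bottomExcess k j ≡ durfeeExcess (n ∸ k) (suc n ∸ j)
bottomExcess≡reversed-durfeeExcess {k} {n} k≤n j with j ≤? k
... | yes j≤k rewrite ≤ᵇ-true j≤k | ≤ᵇ-false (∸-monoʳ-< (s≤s j≤k) (s≤s k≤n)) = refl
... | no  j≰k rewrite ≤ᵇ-false (≰⇒> j≰k) | ≤ᵇ-true (∸-monoʳ-≤ (suc n) (≰⇒> j≰k)) = refl

take≡[]⇔ : ∀ {A : Set} {n} {xs : List A} → n ≤ length xs → take n xs ≡ [] ⇔ n ≡ 0
take≡[]⇔ {n = n} {xs} n≤len = mk⇔ to λ { refl → refl }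
  where
  to : take n xs ≡ [] → n ≡ 0
  to eq = trans (sym (m≤n⇒m⊓n≡m n≤len)) (trans (sym (length-take n xs)) (cong length eq))

drop≡[]⇔ : ∀ {A : Set} {n} {xs : List A} → drop n xs ≡ [] ⇔ length xs ≤ n
drop≡[]⇔ {n = n} {xs} =
  mk⇔ (λ eq → m∸n≡0⇒m≤n (trans (sym (length-drop n xs)) (cong length eq))) (drop-all n xs)

theorem2p3 : (r i : ℕ) → 2 ≤ r → 1 ≤ i → i ≤ r →
    (l : List ℕ) → IsPartition l →
    (InB r i l → InD r i l) × (InD r i l → InB r i l)
theorem2p3 _       zero    _ () _         _ _
theorem2p3 zero    (suc _) _ _  ()        _ _
theorem2p3 (suc n) (suc k) _ _  (s≤s k≤n) l l-partition = Equivalence.to B⇔D , Equivalence.from B⇔D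
  where
  l↓ = IsPartition.nonIncreasing l-partition
  B⇔D : bottom k n l ≡ [] ⇔ durfee (n ∸ k) n l ≡ []
  B⇔D rewrite bottom≡take-bottomSteps k n l | durfee≡drop-topSteps (n ∸ k) n l
            | bottomSteps-cong l (bottomExcess≡reversed-durfeeExcess k≤n) n (length l) =
    ⇔.trans (take≡[]⇔ (bottomSteps-≤ l _ n (length l)))
    (⇔.trans (mk⇔ ≤-reflexive n≤0⇒n≡0)
    (⇔.trans (⇔.sym (topSteps-galois l↓ (durfeeExcess (n ∸ k)) n ≤-refl))
             (⇔.sym drop≡[]⇔)))
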